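{- Let $n$ be a positive integer and $r,t\in\mathbb{Z}$ with $\gcd(r,n)=1$, and let $a_{n,r,t}\in \mathrm{Aut}(\mathrm{D}_{2n})$. Then $|r|_n$ divides the order $|a_{n,r,t}|$, and \[|a_{n,r,t}|=\frac{n|r|_n}{\gcd\left(n,tS_{|r|_n}(r)\right)}=\kappa(n,r,t).\] In particular, $tS_{\kappa(n,r,t)}(r)\equiv 0\pmod n$, and if $\gcd(r-1,n)=1$ then $|a_{n,r,t}|=|r|_n$.
   Context: $|r|_n$ is the multiplicative order of $r$ modulo $n$. $S_k(x)=1+x+\cdots+x^{k-1}$ for $k\ge1$, $S_0(x)=0$; $\kappa(n,r,t)=\dfrac{n|r|_n}{\gcd(n,\ tS_{|r|_n}(r))}$. $\mathrm{D}_{2n}=\langle u_n,v_n\mid u_n^n=v_n^2=1,\ v_nu_nv_n=u_n^{ -1}\rangle$, and $a_{n,r,t}$ is the automorphism $u_n^i\mapsto u_n^{ri}$, $u_n^jv_n\mapsto u_n^{rj+t}v_n$. -}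

module Defs where

open import Data.Nat using (ℕ; zero; suc; _<_)
open import Data.Integer using (ℤ; +_; _+_; _-_; _*_; _^_)
open import Data.Integer.Divisibility using (_∣_)
open import Data.Bool using (Bool; true; false)
open import Data.Product using (_×_; _,_)
open import Relation.Binary.PropositionalEquality using (_≡_)
open import Data.Empty using (⊥)
open import Relation.Nullary using (¬_)

infix 4 _≋_[mod_]
_≋_[mod_] : ℤ → ℤ → ℕ → Set
a ≋ b [mod n ] = (+ n) ∣ (a - b)

IsMulOrder : ℕ → ℤ → ℕ → Set
IsMulOrder n r m =
  (0 < m) × (r ^ m ≋ + 1 [mod n ]) ×
  (∀ k → 0 < k → k < m → ¬ (r ^ k ≋ + 1 [mod n ]))

S : ℕ → ℤ → ℤ
S zero    x = + 0
S (suc k) x = S k x + x ^ k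

-- Elements of D_{2n}: (i , false) represents u^i, (j , true) represents u^j v.
-- The exponent is an integer taken modulo n (D_{2n} as a setoid).
D2 : Set
D2 = ℤ × Bool

_≈[_]_ : D2 → ℕ → D2 → Set
(i , false) ≈[ n ] (j , false) = i ≋ j [mod n ]
(i , true)  ≈[ n ] (j , true)  = i ≋ j [mod n ]
(i , false) ≈[ n ] (j , true)  = ⊥
(i , true)  ≈[ n ] (j , false) = ⊥

a : ℤ → ℤ → D2 → D2
a r t (i , false) = (r * i , false)
a r t (j , true)  = (r * j + t , true)

iter : ℕ → (D2 → D2) → D2 → D2
iter zero    f x = x
iter (suc k) f x = f (iter k f x)

IsIdentity : ℕ → (D2 → D2) → Set
IsIdentity n f = ∀ x → f x ≈[ n ] x

IsAutOrder : ℕ → (D2 → D2) → ℕ → Set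
IsAutOrder n f k =
  (0 < k) × IsIdentity n (iter k f) ×
  (∀ m → 0 < m → m < k → ¬ IsIdentity n (iter m f))

{-# OPTIONS --safe #-}
-- A power a^j acts by u^i ↦ u^(r^j i) and u^i v ↦ u^(r^j i + t S_j(r)) v, so it is the identity
-- iff r^j ≡ 1 and t S_j(r) ≡ 0 (mod n). The first condition means j = p |r|_n, and then
-- r^|r|_n ≡ 1 gives S_j(r) ≡ p S_|r|_n(r), so the second one becomes n ∣ p t S_|r|_n(r), i.e.
-- n / gcd(n, t S_|r|_n(r)) ∣ p. Hence a^j = 1 exactly when κ(n,r,t) ∣ j. If gcd(r - 1, n) = 1,
-- then (r - 1) S_|r|_n(r) = r^|r|_n - 1 ≡ 0 forces S_|r|_n(r) ≡ 0, so a^|r|_n = 1.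
module Submission where

open import Defs
open import Data.Nat using (ℕ; _<_) renaming (_*_ to _*ℕ_)
open import Data.Nat.Divisibility using () renaming (_∣_ to _∣ℕ_)
open import Data.Integer using (ℤ; +_; _-_; _*_)
open import Data.Integer.GCD using (gcd)
open import Data.Product using (Σ; _×_)
open import Relation.Binary.PropositionalEquality using (_≡_)

open import Data.Bool using (true; false)
open import Data.Empty using (⊥-elim)
open import Data.Integer using (_+_; -_; _^_; ∣_∣)
open import Data.Integer.Tactic.RingSolver using (solve-∀)
open import Data.Nat using (zero; suc; NonZero; >-nonZero; ≢-nonZero; ≢-nonZero⁻¹)
  renaming (_+_ to _+ℕ_)
open import Data.Nat.Coprimality using (Coprime; coprime-divisor; gcd≡1⇒coprime)
open import Data.Nat.DivMod using (_%_; _/_; m≡m%n+[m/n]*n; m%n<n)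
open import Data.Nat.Divisibility
  using (divides-refl; ∣-refl; ∣-trans; ∣-antisym; ∣⇒≤; n∣m*n; m%n≡0⇒n∣m;
         *-monoˡ-∣; *-monoʳ-∣; *-cancelʳ-∣)
import Data.Nat.GCD as ℕ
import Data.Nat.Properties as ℕ
import Data.Integer.Divisibility.Signed as Signed
import Data.Integer.Properties as ℤ
open import Algebra.Properties.CommutativeSemigroup ℕ.*-commutativeSemigroup using (xy∙z≈xz∙y)
open import Data.Product using (_,_; proj₁; proj₂)
open import Data.Sum using (inj₁)
open import Function.Bundles using (_⇔_; mk⇔; module Equivalence)
open import Function.Construct.Composition using (_⇔-∘_)
open import Level using (0ℓ)
open import Relation.Binary.Bundles using (Setoid)
open import Relation.Binary.PropositionalEquality
  using (refl; sym; trans; cong; subst; subst₂; module ≡-Reasoning)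
import Relation.Binary.Reasoning.Setoid as SetoidReasoning
open import Relation.Nullary using (yes; no)

open Equivalence using (to; from)

-- _≋_[mod_] boxed in a record: Agda cannot infer x and y from the unfolded n ∣ ∣ x - y ∣,
-- but it can from x ≈ y [mod n ].
infix 4 _≈_[mod_]
record _≈_[mod_] (x y : ℤ) (n : ℕ) : Set where
  constructor box
  field unbox : x ≋ y [mod n ]
open _≈_[mod_]

module _ {n : ℕ} where

  private
    via-∣ : ∀ {x y z} → z ≡ x - y → + n Signed.∣ z → x ≈ y [mod n ]
    via-∣ eq n∣z = box (Signed.∣⇒∣ᵤ (subst (+ n Signed.∣_) eq n∣z))

    ∣- : ∀ {x y} → x ≈ y [mod n ] → + n Signed.∣ x - y
    ∣- (box x≋y) = Signed.∣ᵤ⇒∣ x≋y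

  ≈-refl : ∀ {x} → x ≈ x [mod n ]
  ≈-refl {x} = via-∣ (sym (ℤ.+-inverseʳ x)) (Signed.divides (+ 0) refl)

  ≈-reflexive : ∀ {x y} → x ≡ y → x ≈ y [mod n ]
  ≈-reflexive refl = ≈-refl

  ≈-sym : ∀ {x y} → x ≈ y [mod n ] → y ≈ x [mod n ]
  ≈-sym {x} {y} x≈y = via-∣ (eq x y) (Signed.∣m⇒∣-m (∣- x≈y))
    where
    eq : ∀ x y → - (x - y) ≡ y - x
    eq = solve-∀

  ≈-trans : ∀ {x y z} → x ≈ y [mod n ] → y ≈ z [mod n ] → x ≈ z [mod n ]
  ≈-trans {x} {y} {z} x≈y y≈z = via-∣ (eq x y z) (Signed.∣m∣n⇒∣m+n (∣- x≈y) (∣- y≈z))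
    where
    eq : ∀ x y z → (x - y) + (y - z) ≡ x - z
    eq = solve-∀

  ≈-+-cong : ∀ {x y u v} → x ≈ y [mod n ] → u ≈ v [mod n ] → x + u ≈ y + v [mod n ]
  ≈-+-cong {x} {y} {u} {v} x≈y u≈v = via-∣ (eq x y u v) (Signed.∣m∣n⇒∣m+n (∣- x≈y) (∣- u≈v))
    where
    eq : ∀ x y u v → (x - y) + (u - v) ≡ (x + u) - (y + v)
    eq = solve-∀

  ≈-*-cong : ∀ {x y u v} → x ≈ y [mod n ] → u ≈ v [mod n ] → x * u ≈ y * v [mod n ]
  ≈-*-cong {x} {y} {u} {v} x≈y u≈v =
    via-∣ (eq x y u v) (Signed.∣m∣n⇒∣m+n (Signed.∣m⇒∣m*n u (∣- x≈y)) (Signed.∣n⇒∣m*n y (∣- u≈v)))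
    where
    eq : ∀ x y u v → (x - y) * u + y * (u - v) ≡ x * u - y * v
    eq = solve-∀

  ≈-resp-≈0 : ∀ {x y} → x ≈ y [mod n ] → x ≈ + 0 [mod n ] ⇔ y ≈ + 0 [mod n ]
  ≈-resp-≈0 x≈y = mk⇔ (≈-trans (≈-sym x≈y)) (≈-trans x≈y)

  ≈0⇔∣∣ : ∀ {x} → x ≈ + 0 [mod n ] ⇔ n ∣ℕ ∣ x ∣
  ≈0⇔∣∣ {x} = mk⇔ (λ x≈0 → subst (λ y → n ∣ℕ ∣ y ∣) (ℤ.+-identityʳ x) (unbox x≈0))
                  (λ n∣x → box (subst (λ y → n ∣ℕ ∣ y ∣) (sym (ℤ.+-identityʳ x)) n∣x))

≈-setoid : ℕ → Setoid 0ℓ 0ℓ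
≈-setoid n = record
  { Carrier       = ℤ
  ; _≈_           = _≈_[mod n ]
  ; isEquivalence = record { refl = ≈-refl ; sym = ≈-sym ; trans = ≈-trans }
  }

module ≈-Reasoning (n : ℕ) = SetoidReasoning (≈-setoid n)

S-suc : ∀ k x → S (suc k) x ≡ + 1 + x * S k x
S-suc zero    x = cong (_+_ (+ 1)) (sym (ℤ.*-zeroʳ x))
S-suc (suc k) x = begin
  S (suc k) x + x * x ^ k          ≡⟨ cong (_+ x * x ^ k) (S-suc k x) ⟩
  + 1 + x * S k x + x * x ^ k      ≡⟨ eq x (S k x) (x ^ k) ⟩
  + 1 + x * (S k x + x ^ k)        ∎
  where
  open ≡-Reasoning
  eq : ∀ x s p → + 1 + x * s + x * p ≡ + 1 + x * (s + p)
  eq = solve-∀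

S-+ : ∀ k l x → S (k +ℕ l) x ≡ S k x + x ^ k * S l x
S-+ zero    l x = sym (trans (ℤ.+-identityˡ (+ 1 * S l x)) (ℤ.*-identityˡ (S l x)))
S-+ (suc k) l x = begin
  S (suc (k +ℕ l)) x                      ≡⟨ S-suc (k +ℕ l) x ⟩
  + 1 + x * S (k +ℕ l) x                  ≡⟨ cong (λ s → + 1 + x * s) (S-+ k l x) ⟩
  + 1 + x * (S k x + x ^ k * S l x)       ≡⟨ eq x (S k x) (x ^ k) (S l x) ⟩
  (+ 1 + x * S k x) + x * x ^ k * S l x   ≡⟨ cong (_+ x * x ^ k * S l x) (S-suc k x) ⟨
  S (suc k) x + x * x ^ k * S l x         ∎
  where
  open ≡-Reasoning
  eq : ∀ x s p s′ → + 1 + x * (s + p * s′) ≡ (+ 1 + x * s) + x * p * s′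
  eq = solve-∀

geometric-sum : ∀ k x → (x - + 1) * S k x ≡ x ^ k - + 1
geometric-sum zero    x = ℤ.*-zeroʳ (x - + 1)
geometric-sum (suc k) x = begin
  (x - + 1) * (S k x + x ^ k)               ≡⟨ eq x (S k x) (x ^ k) ⟩
  (x - + 1) * S k x + (x * x ^ k - x ^ k)   ≡⟨ cong (_+ (x * x ^ k - x ^ k)) (geometric-sum k x) ⟩
  (x ^ k - + 1) + (x * x ^ k - x ^ k)       ≡⟨ eq′ x (x ^ k) ⟩
  x * x ^ k - + 1                           ∎
  where
  open ≡-Reasoning
  eq : ∀ x s p → (x - + 1) * (s + p) ≡ (x - + 1) * s + (x * p - p)
  eq = solve-∀
  eq′ : ∀ x p → (p - + 1) + (x * p - p) ≡ x * p - + 1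
  eq′ = solve-∀

module _ {n m : ℕ} {x : ℤ} (x^m≈1 : x ^ m ≈ + 1 [mod n ]) where
  open ≈-Reasoning n

  ^[p*m]≈1 : ∀ p → x ^ (p *ℕ m) ≈ + 1 [mod n ]
  ^[p*m]≈1 zero    = ≈-refl
  ^[p*m]≈1 (suc p) = begin
    x ^ (m +ℕ p *ℕ m)      ≡⟨ ℤ.^-distribˡ-+-* x m (p *ℕ m) ⟩
    x ^ m * x ^ (p *ℕ m)   ≈⟨ ≈-*-cong x^m≈1 (^[p*m]≈1 p) ⟩
    + 1                    ∎

  S[p*m]≈p*S[m] : ∀ p → S (p *ℕ m) x ≈ + p * S m x [mod n ]
  S[p*m]≈p*S[m] zero    = ≈-refl
  S[p*m]≈p*S[m] (suc p) = begin
    S (m +ℕ p *ℕ m) x                   ≡⟨ S-+ m (p *ℕ m) x ⟩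
    S m x + x ^ m * S (p *ℕ m) x
      ≈⟨ ≈-+-cong (≈-refl {x = S m x}) (≈-*-cong x^m≈1 (S[p*m]≈p*S[m] p)) ⟩
    S m x + + 1 * (+ p * S m x)         ≡⟨ eq (S m x) (+ p) ⟩
    + suc p * S m x                     ∎
    where
    eq : ∀ s p → s + + 1 * (p * s) ≡ (+ 1 + p) * s
    eq = solve-∀

  coprime[n,x-1]⇒S≈0 : Coprime n ∣ x - + 1 ∣ → S m x ≈ + 0 [mod n ]
  coprime[n,x-1]⇒S≈0 cop = from ≈0⇔∣∣ (coprime-divisor cop n∣[x-1]*S)
    where
    [x-1]*S≈0 : (x - + 1) * S m x ≈ + 0 [mod n ]
    [x-1]*S≈0 = begin
      (x - + 1) * S m x   ≡⟨ geometric-sum m x ⟩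
      x ^ m - + 1         ≈⟨ ≈-+-cong x^m≈1 (≈-refl {x = - + 1}) ⟩
      + 0                 ∎
    n∣[x-1]*S : n ∣ℕ ∣ x - + 1 ∣ *ℕ ∣ S m x ∣
    n∣[x-1]*S = subst (n ∣ℕ_) (ℤ.abs-* (x - + 1) (S m x)) (to ≈0⇔∣∣ [x-1]*S≈0)

IsMulOrder⇒∣ : ∀ {n r m} → IsMulOrder n r m → ∀ j → r ^ j ≈ + 1 [mod n ] → m ∣ℕ j
IsMulOrder⇒∣ {n} {r} {m@(suc _)} (_ , r^m≋1 , minimal) j r^j≈1 with j % m ℕ.≟ 0
... | yes j%m≡0 = m%n≡0⇒n∣m j m j%m≡0
... | no  j%m≢0 = ⊥-elim (minimal (j % m) (ℕ.n≢0⇒n>0 j%m≢0) (m%n<n j m) (unbox r^[j%m]≈1))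
  where
  open ≈-Reasoning n
  r^[j%m]≈1 : r ^ (j % m) ≈ + 1 [mod n ]
  r^[j%m]≈1 = begin
    r ^ (j % m)                          ≡⟨ ℤ.*-identityʳ (r ^ (j % m)) ⟨
    r ^ (j % m) * + 1
      ≈⟨ ≈-*-cong (≈-refl {x = r ^ (j % m)}) (^[p*m]≈1 {x = r} (box r^m≋1) (j / m)) ⟨
    r ^ (j % m) * r ^ (j / m *ℕ m)       ≡⟨ ℤ.^-distribˡ-+-* r (j % m) (j / m *ℕ m) ⟨
    r ^ (j % m +ℕ j / m *ℕ m)            ≡⟨ cong (r ^_) (m≡m%n+[m/n]*n j m) ⟨
    r ^ j                                ≈⟨ r^j≈1 ⟩
    + 1                                  ∎

module _ (r t : ℤ) where

  iter-a-rotation : ∀ j i → iter j (a r t) (i , false) ≡ (r ^ j * i , false)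
  iter-a-rotation zero    i = cong (_, false) (sym (ℤ.*-identityˡ i))
  iter-a-rotation (suc j) i rewrite iter-a-rotation j i =
    cong (_, false) (sym (ℤ.*-assoc r (r ^ j) i))

  iter-a-reflection : ∀ j i → iter j (a r t) (i , true) ≡ (r ^ j * i + t * S j r , true)
  iter-a-reflection zero    i = cong (_, true) (eq i t)
    where
    eq : ∀ i t → i ≡ + 1 * i + t * + 0
    eq = solve-∀
  iter-a-reflection (suc j) i rewrite iter-a-reflection j i = cong (_, true) (begin
    r * (r ^ j * i + t * S j r) + t       ≡⟨ eq r (r ^ j) i t (S j r) ⟩
    r * r ^ j * i + t * (+ 1 + r * S j r) ≡⟨ cong (λ s → r * r ^ j * i + t * s) (S-suc j r) ⟨
    r * r ^ j * i + t * S (suc j) r       ∎)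
    where
    open ≡-Reasoning
    eq : ∀ r p i t s → r * (p * i + t * s) + t ≡ r * p * i + t * (+ 1 + r * s)
    eq = solve-∀

  iter-a-identity⇔ : ∀ {n} j →
    IsIdentity n (iter j (a r t)) ⇔ (r ^ j ≈ + 1 [mod n ] × t * S j r ≈ + 0 [mod n ])
  iter-a-identity⇔ {n} j = mk⇔ necessary sufficient
    where
    open ≈-Reasoning n

    necessary : IsIdentity n (iter j (a r t)) → r ^ j ≈ + 1 [mod n ] × t * S j r ≈ + 0 [mod n ]
    necessary id = ≈-trans (≈-reflexive (sym (ℤ.*-identityʳ (r ^ j)))) (box u↦u)
                 , ≈-trans (≈-reflexive (eq (r ^ j) (t * S j r))) (box v↦v)
      where
      u↦u : r ^ j * + 1 ≋ + 1 [mod n ]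
      u↦u = subst (_≈[ n ] (+ 1 , false)) (iter-a-rotation j (+ 1)) (id (+ 1 , false))
      v↦v : r ^ j * + 0 + t * S j r ≋ + 0 [mod n ]
      v↦v = subst (_≈[ n ] (+ 0 , true)) (iter-a-reflection j (+ 0)) (id (+ 0 , true))
      eq : ∀ p s → s ≡ p * + 0 + s
      eq = solve-∀

    sufficient : r ^ j ≈ + 1 [mod n ] × t * S j r ≈ + 0 [mod n ] → IsIdentity n (iter j (a r t))
    sufficient (r^j≈1 , tS≈0) (i , false) rewrite iter-a-rotation j i = unbox (begin
      r ^ j * i   ≈⟨ ≈-*-cong r^j≈1 (≈-refl {x = i}) ⟩
      + 1 * i     ≡⟨ ℤ.*-identityˡ i ⟩
      i           ∎)
    sufficient (r^j≈1 , tS≈0) (i , true) rewrite iter-a-reflection j i = unbox (begin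
      r ^ j * i + t * S j r   ≈⟨ ≈-+-cong (≈-*-cong r^j≈1 (≈-refl {x = i})) tS≈0 ⟩
      + 1 * i + + 0           ≡⟨ eq i ⟩
      i                       ∎)
      where
      eq : ∀ i → + 1 * i + + 0 ≡ i
      eq = solve-∀

n∣p*x⇔q∣p : ∀ {n x q} p .{{_ : NonZero n}} → q *ℕ ℕ.gcd n x ≡ n → n ∣ℕ p *ℕ x ⇔ q ∣ℕ p
n∣p*x⇔q∣p {n} {x} {q} p q*g≡n = mk⇔ cancel-gcd multiply
  where
  g : ℕ
  g = ℕ.gcd n x

  instance
    g≢0 : NonZero g
    g≢0 = ≢-nonZero (ℕ.gcd[m,n]≢0 n x (inj₁ (≢-nonZero⁻¹ n)))

  cancel-gcd : n ∣ℕ p *ℕ x → q ∣ℕ p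
  cancel-gcd n∣p*x = *-cancelʳ-∣ g
    (subst₂ _∣ℕ_ (sym q*g≡n) (sym (ℕ.c*gcd[m,n]≡gcd[cm,cn] p n x)) (ℕ.gcd-greatest (n∣m*n p) n∣p*x))

  multiply : q ∣ℕ p → n ∣ℕ p *ℕ x
  multiply (divides-refl c) =
    ∣-trans n∣q*x (subst (q *ℕ x ∣ℕ_) (sym (ℕ.*-assoc c q x)) (n∣m*n c))
    where
    n∣q*x : n ∣ℕ q *ℕ x
    n∣q*x = subst (_∣ℕ q *ℕ x) q*g≡n (*-monoʳ-∣ q (ℕ.gcd[m,n]∣n n x))

identity⇔∣⇒IsAutOrder : ∀ {n f k} → 0 < k →
  (∀ j → IsIdentity n (iter j f) ⇔ k ∣ℕ j) → IsAutOrder n f k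
identity⇔∣⇒IsAutOrder {k = k} k>0 identity⇔∣ =
  k>0 , from (identity⇔∣ k) ∣-refl ,
  λ j j>0 j<k id → ℕ.<⇒≱ j<k (∣⇒≤ {{>-nonZero j>0}} (to (identity⇔∣ j) id))

module AutomorphismOrder {n : ℕ} .{{_ : NonZero n}} {r : ℤ} (t : ℤ) {m : ℕ}
                         (r-order : IsMulOrder n r m) where
  open ≈-Reasoning n

  r^m≈1 : r ^ m ≈ + 1 [mod n ]
  r^m≈1 = box (proj₁ (proj₂ r-order))

  g : ℕ
  g = ℕ.gcd n ∣ t * S m r ∣

  q : ℕ
  q = _∣ℕ_.quotient (ℕ.gcd[m,n]∣m n ∣ t * S m r ∣)

  n≡q*g : n ≡ q *ℕ g
  n≡q*g = _∣ℕ_.equality (ℕ.gcd[m,n]∣m n ∣ t * S m r ∣)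

  κ : ℕ
  κ = q *ℕ m

  t*S[p*m]≈p*t*S[m] : ∀ p → t * S (p *ℕ m) r ≈ + p * (t * S m r) [mod n ]
  t*S[p*m]≈p*t*S[m] p = begin
    t * S (p *ℕ m) r      ≈⟨ ≈-*-cong (≈-refl {x = t}) (S[p*m]≈p*S[m] r^m≈1 p) ⟩
    t * (+ p * S m r)     ≡⟨ eq t (+ p) (S m r) ⟩
    + p * (t * S m r)     ∎
    where
    eq : ∀ t p s → t * (p * s) ≡ p * (t * s)
    eq = solve-∀

  t*S[p*m]≈0⇔q∣p : ∀ p → t * S (p *ℕ m) r ≈ + 0 [mod n ] ⇔ q ∣ℕ p
  t*S[p*m]≈0⇔q∣p p =
    n∣p*x⇔q∣p p (sym n≡q*g)
      ⇔-∘ (subst (λ z → + p * (t * S m r) ≈ + 0 [mod n ] ⇔ n ∣ℕ z)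
                 (ℤ.abs-* (+ p) (t * S m r)) ≈0⇔∣∣
      ⇔-∘ ≈-resp-≈0 (t*S[p*m]≈p*t*S[m] p))

  iter[p*m]-identity⇔q∣p : ∀ p → IsIdentity n (iter (p *ℕ m) (a r t)) ⇔ q ∣ℕ p
  iter[p*m]-identity⇔q∣p p =
    t*S[p*m]≈0⇔q∣p p
      ⇔-∘ (mk⇔ proj₂ (^[p*m]≈1 r^m≈1 p ,_) ⇔-∘ iter-a-identity⇔ r t (p *ℕ m))

  iter-identity⇔κ∣ : ∀ j → IsIdentity n (iter j (a r t)) ⇔ κ ∣ℕ j
  iter-identity⇔κ∣ j = mk⇔ identity⇒κ∣ κ∣⇒identity
    where
    identity⇒κ∣ : IsIdentity n (iter j (a r t)) → κ ∣ℕ j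
    identity⇒κ∣ id with IsMulOrder⇒∣ r-order j (proj₁ (to (iter-a-identity⇔ r t j) id))
    ... | divides-refl p = *-monoˡ-∣ m (to (iter[p*m]-identity⇔q∣p p) id)

    κ∣⇒identity : κ ∣ℕ j → IsIdentity n (iter j (a r t))
    κ∣⇒identity (divides-refl c) =
      subst (λ j → IsIdentity n (iter j (a r t))) (ℕ.*-assoc c q m)
            (from (iter[p*m]-identity⇔q∣p (c *ℕ q)) (n∣m*n c))

  κ-isAutOrder : IsAutOrder n (a r t) κ
  κ-isAutOrder = identity⇔∣⇒IsAutOrder (ℕ.*-mono-≤ q>0 (proj₁ r-order)) iter-identity⇔κ∣
    where
    q>0 : 0 < q
    q>0 = ℕ.n≢0⇒n>0 λ q≡0 → ≢-nonZero⁻¹ n (trans n≡q*g (cong (_*ℕ g) q≡0))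

  κ*g≡n*m : κ *ℕ g ≡ n *ℕ m
  κ*g≡n*m = trans (xy∙z≈xz∙y q m g) (cong (_*ℕ m) (sym n≡q*g))

  t*S[κ]≈0 : t * S κ r ≈ + 0 [mod n ]
  t*S[κ]≈0 = proj₂ (to (iter-a-identity⇔ r t κ) (from (iter-identity⇔κ∣ κ) ∣-refl))

  coprime[n,r-1]⇒κ≡m : Coprime n ∣ r - + 1 ∣ → κ ≡ m
  coprime[n,r-1]⇒κ≡m cop = ∣-antisym (to (iter-identity⇔κ∣ m) a^m≡id) (n∣m*n q)
    where
    a^m≡id : IsIdentity n (iter m (a r t))
    a^m≡id = from (iter-a-identity⇔ r t m) (r^m≈1 , (begin
      t * S m r   ≈⟨ ≈-*-cong (≈-refl {x = t}) (coprime[n,x-1]⇒S≈0 {m = m} {x = r} r^m≈1 cop) ⟩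
      t * + 0     ≡⟨ ℤ.*-zeroʳ t ⟩
      + 0         ∎))

lemma3p4 : (n : ℕ) → 0 < n → (r t : ℤ) → gcd r (+ n) ≡ + 1 →
    (m : ℕ) → IsMulOrder n r m →
    Σ ℕ (λ k → IsAutOrder n (a r t) k
    × m ∣ℕ k
    × (+ k) * gcd (+ n) (t * S m r) ≡ + (n *ℕ m)
    × (t * S k r ≋ + 0 [mod n ])
    × (gcd (r - + 1) (+ n) ≡ + 1 → k ≡ m))
lemma3p4 n n>0 r t _ m r-order =
  κ , κ-isAutOrder , n∣m*n q , trans (sym (ℤ.pos-* κ g)) (cong +_ κ*g≡n*m) , unbox t*S[κ]≈0 ,
  λ gcd≡1 → coprime[n,r-1]⇒κ≡m
              (gcd≡1⇒coprime (trans (ℕ.gcd-comm n ∣ r - + 1 ∣) (ℤ.+-injective gcd≡1)))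
  where open AutomorphismOrder {{>-nonZero n>0}} t r-order
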